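{- Consider the union-find data structure with union-by-size and path compression on $n$ elements, as described in the context. There is an absolute constant $C$ such that for every $n\ge 2$, every $m\ge 0$ and every sequence consisting of at most $n$ union steps and $m$ find steps, the total cost of the sequence is at most $C\,(m+n)\,\widehat{\log^{**}}(n)$.
   Context: The data structure maintains a rooted forest on $n$ elements (nodes); each tree represents a set. Initially every node is its own root and $\textsc{Size}(p)=1$ for all $p$. At any time, $\textsc{Size}(p)$ is the current number of descendants of $p$, including $p$. A find step on a node $p$: let $p=p_1\to\cdots\to p_k=r$ be the path from $p$ to the root $r$ of its tree; every node on the path is made a child of $r$; the cost is the length of this path. A union step on two roots $r_a\neq r_b$ of different trees: if $\textsc{Size}(r_a)<\textsc{Size}(r_b)$ swap them; then $r_b$ is made a child of $r_a$ and $\textsc{Size}(r_a)\leftarrow\textsc{Size}(r_a)+\textsc{Size}(r_b)$; the cost is $1$. Logarithms are base $2$. Define $\widehat{\log^{*}}(x)$ as the minimum $k\ge 0$ such that applying the map $y\mapsto\left(\frac{1+\log y}{8}\right)^4$ $k$ times to $x$ yields a value at most $1$, and $\widehat{\log^{**}}(x)$ as the minimum $k\ge0$ such that applying the map $y\mapsto\left(\frac{1+\widehat{\log^{*}}(y)}{8}\right)^4$ $k$ times to $x$ yields a value at most $1$. -}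

module Defs where

open import Data.Nat as ℕ using (ℕ; zero; suc; _<_; NonZero)
open import Data.Integer using (+_)
open import Data.Rational as ℚ using (ℚ; _/_; 0ℚ; 1ℚ)
open import Data.Fin using (Fin)
open import Data.Fin.Properties using (_≟_)
open import Data.List using (List; []; _∷_; length)
import Data.List.Membership.DecPropositional as DecMem
open import Data.Product using (Σ; _×_; _,_)
open import Data.Bool using (if_then_else_)
open import Relation.Nullary using (¬_; does)
open import Relation.Binary.PropositionalEquality using (_≡_; _≢_)

_^ℚ_ : ℚ → ℕ → ℚ
q ^ℚ zero  = 1ℚ
q ^ℚ suc k = q ℚ.* (q ^ℚ k)

ℕ→ℚ : ℕ → ℚ
ℕ→ℚ k = (+ k) / 1

-- The iterated map  f(y) = ((1 + log₂ y) / 8)^4  on positive reals.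
--
-- There are no reals in agda-stdlib, so the real number f^k(x) is
-- represented by its (Dedekind) lower cut:
--   LowerCut k x r   means   r < f^k(x)      (for rational r).
-- This is meaningful as long as f is only applied to arguments > 1,
-- which is guaranteed wherever it is used below.
--
-- For z > 1 and rational r:
--   r < f(z)  iff  there are naturals a, b = suc b' and a rational w with
--     0 < w < z,  2^(a/b) < 2w  (i.e. a/b < 1 + log₂ w,
--     equivalently 2^a < (2w)^b),  and  r < (a/(8b))^4.
-- (Here t = a/b ranges over the nonnegative rationals, t plays the role
--  of 1 + log₂ of something below z.)
LowerCut : ℕ → ℚ → ℚ → Set
LowerCut zero    x r = r ℚ.< x
LowerCut (suc k) x r =
  Σ ℕ λ a → Σ ℕ λ b' → Σ ℚ λ w →
      (0ℚ ℚ.< w)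
    × (ℕ→ℚ (2 ℕ.^ a) ℚ.< ((ℕ→ℚ 2 ℚ.* w) ^ℚ suc b'))
    × (r ℚ.< ((+ a / (8 ℕ.* suc b')) ^ℚ 4))
    × LowerCut k x w

-- IsLogStar x k :  k = log*^(x), i.e. k is the least natural number such
-- that applying y ↦ ((1 + log₂ y)/8)^4  k times to x gives a value ≤ 1.
-- (f^k(x) ≤ 1 is ¬ (1 < f^k(x)); minimality says all earlier iterates > 1.)
IsLogStar : ℚ → ℕ → Set
IsLogStar x k = (¬ LowerCut k x 1ℚ) × (∀ j → j < k → LowerCut j x 1ℚ)

-- the map y ↦ ((1 + j)/8)^4 where j = log*^(y)
g : ℕ → ℚ
g j = (+ suc j / 8) ^ℚ 4

-- IsLogStarStar x k :  k = log**^(x): least k such that applying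
-- y ↦ ((1 + log*^(y))/8)^4  k times to x gives a value ≤ 1.
data IsLogStarStar : ℚ → ℕ → Set where
  done : ∀ {x} → x ℚ.≤ 1ℚ → IsLogStarStar x zero
  next : ∀ {x j k} → 1ℚ ℚ.< x → IsLogStar x j →
         IsLogStarStar (g j) k → IsLogStarStar x (suc k)

record State (n : ℕ) : Set where
  constructor st
  field
    parent : Fin n → Fin n
    size   : Fin n → ℕ
open State public

initState : (n : ℕ) → State n
initState n = st (λ p → p) (λ _ → 1)

upd : ∀ {n} {A : Set} → (Fin n → A) → Fin n → A → Fin n → A
upd f i v j = if does (j ≟ i) then v else f j

data Path {n : ℕ} (par : Fin n → Fin n) : Fin n → List (Fin n) → Fin n → Set where
  atRoot : ∀ {r} → par r ≡ r → Path par r (r ∷ []) r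
  up     : ∀ {p ps r} → par p ≢ p → Path par (par p) ps r → Path par p (p ∷ ps) r

data Op (n : ℕ) : Set where
  find  : Fin n → Op n
  union : Fin n → Fin n → Op n

compress : ∀ {n} → (Fin n → Fin n) → List (Fin n) → Fin n → Fin n → Fin n
compress {n} par ps r x = if does (x ∈? ps) then r else par x
  where open DecMem (_≟_ {n}) using (_∈?_)

data Step {n : ℕ} : State n → Op n → State n → ℕ → Set where
  findStep : ∀ {s p ps r} → Path (parent s) p ps r →
    Step s (find p) (st (compress (parent s) ps r) (size s)) (length ps)
  unionKeep : ∀ {s a b} → parent s a ≡ a → parent s b ≡ b → a ≢ b →
    ¬ (size s a < size s b) →
    Step s (union a b) (st (upd (parent s) b a) (upd (size s) a (size s a ℕ.+ size s b))) 1
  unionSwap : ∀ {s a b} → parent s a ≡ a → parent s b ≡ b → a ≢ b →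
    size s a < size s b →
    Step s (union a b) (st (upd (parent s) a b) (upd (size s) b (size s b ℕ.+ size s a))) 1

data Run {n : ℕ} : State n → List (Op n) → State n → ℕ → Set where
  nil  : ∀ {s} → Run s [] s 0
  cons : ∀ {s op ops s₁ s₂ c cs} → Step s op s₁ c → Run s₁ ops s₂ cs →
         Run s (op ∷ ops) s₂ (c ℕ.+ cs)

numFinds : ∀ {n} → List (Op n) → ℕ
numFinds []             = 0
numFinds (find _ ∷ os)  = suc (numFinds os)
numFinds (union _ _ ∷ os) = numFinds os

numUnions : ∀ {n} → List (Op n) → ℕ
numUnions []             = 0
numUnions (find _ ∷ os)  = numUnions os
numUnions (union _ _ ∷ os) = suc (numUnions os)

-- Union by size keeps 2 · size x ≤ size (parent x), so the ranks r x = ⌊log₂ (size x)⌋ strictly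
-- increase along every path and are at most n. Following Tarjan, fix K levels of Ackermann's
-- function A and give a non-root x the potential K · r x minus the number of pairs (k, i), k < K,
-- i < r x, with A_k^(i+1) (r x) ≤ r (parent x). A union raises the total potential by at most K.
-- When a path is compressed, every node loses potential except at most one per level k and three more,
-- so a find costs at most K + 3 amortised. This needs all ranks below A_K 1. Finally
-- log**(n) = L forces n < A_(5+L) 1, because unlog r = 2^(8 · 2^r) satisfies f (unlog r) > r for
-- the map f iterated by log*; with K = 5 + L the cost is at most (L + 8)(m + n) ≤ 9 (m + n) L.

module Submission where

open import Defs
open import Data.Nat
  using (ℕ; zero; suc; _+_; _*_; _^_; _∸_; _≤_; _<_; _≤?_; _≤′_; ≤′-step; ≤′-reflexive; z≤n; s≤s)
open import Data.Nat.Properties hiding (_≟_)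
open import Data.Nat.GeneralisedArithmetic using (fold; fold-+)
open import Data.Nat.Logarithm using (⌊log₂_⌋; ⌊log₂⌋-mono-≤; ⌊log₂[2*b]⌋≡1+⌊log₂b⌋; ⌊log₂[2^n]⌋≡n)
open import Data.Nat.ListAction using () renaming (sum to sumᴸ)
open import Data.Nat.Tactic.RingSolver using (solve-∀)
open import Data.Integer as ℤ using (+≤+; +<+)
import Data.Integer.Properties as ℤ
open import Data.Rational as ℚ using (_/_; toℚᵘ)
import Data.Rational.Properties as ℚ
open import Data.Rational.Unnormalised as ℚᵘ using (ℚᵘ; mkℚᵘ; *<*; *≤*)
  renaming (_≃_ to _≃ᵘ_; _<_ to _<ᵘ_; _≤_ to _≤ᵘ_)
import Data.Rational.Unnormalised.Properties as ℚᵘ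
open import Data.Fin using (Fin; zero; suc; toℕ; fromℕ<; punchIn)
open import Data.Fin.Properties using (_≟_; toℕ-fromℕ<; punchInᵢ≢i)
open import Data.Vec.Functional using (removeAt)
open import Algebra.Properties.CommutativeMonoid.Sum +-0-commutativeMonoid using (sum; sum-cong-≗; sum-remove)
open import Data.List as List using (List; []; _∷_; length)
open import Data.List.Relation.Unary.All using (All; []; _∷_)
open import Data.List.Relation.Unary.All.Properties.Core using (¬Any⇒All¬)
open import Data.List.Relation.Unary.Any using (here; there)
open import Data.List.Relation.Unary.Unique.Propositional using (Unique; []; _∷_)
open import Data.List.Membership.Propositional using (_∈_; _∉_)
import Data.List.Membership.DecPropositional as DecMembership
open import Data.Product using (Σ; _×_; _,_; proj₁; proj₂)
open import Data.Sum using (_⊎_; inj₁; inj₂)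
open import Data.Empty using (⊥-elim)
open import Function.Base using (_∘_)
open import Relation.Nullary using (Dec; yes; no; ¬_; contradiction)
open import Relation.Binary.Core using (_Preserves_⟶_)
open import Relation.Binary.PropositionalEquality

-- Rational comparisons

-- Comparisons are carried out in ℚᵘ, where products are not normalised.
_^ᵘ_ : ℚᵘ → ℕ → ℚᵘ
q ^ᵘ zero  = ℚᵘ.1ℚᵘ
q ^ᵘ suc k = q ℚᵘ.* (q ^ᵘ k)

^ᵘ-congˡ : ∀ {p q} k → p ≃ᵘ q → p ^ᵘ k ≃ᵘ q ^ᵘ k
^ᵘ-congˡ zero    p≃q = ℚᵘ.≃-refl
^ᵘ-congˡ (suc k) p≃q = ℚᵘ.*-cong p≃q (^ᵘ-congˡ k p≃q)

toℚᵘ-homo-^ : ∀ q k → toℚᵘ (q ^ℚ k) ≃ᵘ toℚᵘ q ^ᵘ k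
toℚᵘ-homo-^ q zero    = ℚᵘ.≃-refl
toℚᵘ-homo-^ q (suc k) =
  ℚᵘ.≃-trans (ℚ.toℚᵘ-homo-* q (q ^ℚ k)) (ℚᵘ.*-congˡ {toℚᵘ q} (toℚᵘ-homo-^ q k))

pos-^ : ∀ a k → (ℤ.+ a) ℤ.^ k ≡ ℤ.+ (a ^ k)
pos-^ a zero    = refl
pos-^ a (suc k) = trans (cong (ℤ.+ a ℤ.*_) (pos-^ a k)) (sym (ℤ.pos-* a (a ^ k)))

toℚᵘ-/ : ∀ a d → toℚᵘ (ℤ.+ a / suc d) ≃ᵘ mkℚᵘ (ℤ.+ a) d
toℚᵘ-/ a d = ℚ.toℚᵘ-fromℚᵘ (mkℚᵘ (ℤ.+ a) d)

<-via-toℚᵘ : ∀ {p q P Q} → toℚᵘ p ≃ᵘ P → toℚᵘ q ≃ᵘ Q → P <ᵘ Q → p ℚ.< q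
<-via-toℚᵘ p≃P q≃Q P<Q =
  ℚ.toℚᵘ-cancel-< (ℚᵘ.<-respˡ-≃ (ℚᵘ.≃-sym p≃P) (ℚᵘ.<-respʳ-≃ (ℚᵘ.≃-sym q≃Q) P<Q))

≤-via-toℚᵘ : ∀ {p q P Q} → toℚᵘ p ≃ᵘ P → toℚᵘ q ≃ᵘ Q → p ℚ.≤ q → P ≤ᵘ Q
≤-via-toℚᵘ p≃P q≃Q p≤q = ℚᵘ.≤-respˡ-≃ p≃P (ℚᵘ.≤-respʳ-≃ q≃Q (ℚ.toℚᵘ-mono-≤ p≤q))

mkℚᵘ-mono-< : ∀ {a b d e} → a * suc e < b * suc d → mkℚᵘ (ℤ.+ a) d <ᵘ mkℚᵘ (ℤ.+ b) e
mkℚᵘ-mono-< {a} {b} {d} {e} lt =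
  *<* (subst₂ ℤ._<_ (ℤ.pos-* a (suc e)) (ℤ.pos-* b (suc d)) (+<+ lt))

mkℚᵘ-cancel-≤ : ∀ {a b d e} → mkℚᵘ (ℤ.+ a) d ≤ᵘ mkℚᵘ (ℤ.+ b) e → a * suc e ≤ b * suc d
mkℚᵘ-cancel-≤ {a} {b} {d} {e} (*≤* le) with subst₂ ℤ._≤_ (sym (ℤ.pos-* a (suc e))) (sym (ℤ.pos-* b (suc d))) le
... | +≤+ le′ = le′

ℕ→ℚ-mono-< : ∀ {a b} → a < b → ℕ→ℚ a ℚ.< ℕ→ℚ b
ℕ→ℚ-mono-< {a} {b} a<b = <-via-toℚᵘ (toℚᵘ-/ a 0) (toℚᵘ-/ b 0)
  (mkℚᵘ-mono-< (subst₂ _<_ (sym (*-identityʳ a)) (sym (*-identityʳ b)) a<b))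

ℕ→ℚ-cancel-≤ : ∀ {a b} → ℕ→ℚ a ℚ.≤ ℕ→ℚ b → a ≤ b
ℕ→ℚ-cancel-≤ {a} {b} le = subst₂ _≤_ (*-identityʳ a) (*-identityʳ b)
  (mkℚᵘ-cancel-≤ (≤-via-toℚᵘ (toℚᵘ-/ a 0) (toℚᵘ-/ b 0) le))

ℕ→ℚ-mono-≤ : ∀ {a b} → a ≤ b → ℕ→ℚ a ℚ.≤ ℕ→ℚ b
ℕ→ℚ-mono-≤ a≤b with m≤n⇒m<n∨m≡n a≤b
... | inj₁ a<b = ℚ.<⇒≤ (ℕ→ℚ-mono-< a<b)
... | inj₂ refl = ℚ.≤-refl

ℕ→ℚ<[a/8]^4 : ∀ r a → r * 4096 < a ^ 4 → ℕ→ℚ r ℚ.< (ℤ.+ a / 8) ^ℚ 4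
ℕ→ℚ<[a/8]^4 r a lt = <-via-toℚᵘ (toℚᵘ-/ r 0) fourth
  (mkℚᵘ-mono-< (subst (r * 4096 <_) (sym (*-identityʳ (a ^ 4))) lt))
  where
  fourth : toℚᵘ ((ℤ.+ a / 8) ^ℚ 4) ≃ᵘ mkℚᵘ (ℤ.+ (a ^ 4)) 4095
  fourth = ℚᵘ.≃-trans (toℚᵘ-homo-^ (ℤ.+ a / 8) 4)
    (ℚᵘ.≃-trans (^ᵘ-congˡ 4 (toℚᵘ-/ a 7)) (ℚᵘ.≃-reflexive (cong (λ z → mkℚᵘ z 4095) (pos-^ a 4))))

ℕ→ℚ<[2w]^1 : ∀ x w → x < 2 * w → ℕ→ℚ x ℚ.< (ℕ→ℚ 2 ℚ.* ℕ→ℚ w) ^ℚ 1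
ℕ→ℚ<[2w]^1 x w lt = <-via-toℚᵘ (toℚᵘ-/ x 0) double
  (mkℚᵘ-mono-< (subst₂ _<_ (sym (*-identityʳ x)) (sym (*-identityʳ (2 * w))) lt))
  where
  double : toℚᵘ ((ℕ→ℚ 2 ℚ.* ℕ→ℚ w) ^ℚ 1) ≃ᵘ mkℚᵘ (ℤ.+ (2 * w)) 0
  double = ℚᵘ.≃-trans (toℚᵘ-homo-^ (ℕ→ℚ 2 ℚ.* ℕ→ℚ w) 1)
    (ℚᵘ.≃-trans (^ᵘ-congˡ 1 (ℚᵘ.≃-trans (ℚ.toℚᵘ-homo-* (ℕ→ℚ 2) (ℕ→ℚ w)) (ℚᵘ.*-cong (toℚᵘ-/ 2 0) (toℚᵘ-/ w 0))))
      (ℚᵘ.≃-reflexive (cong (λ z → mkℚᵘ z 0) (trans (ℤ.*-identityʳ _) (sym (ℤ.pos-* 2 w))))))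

-- Ackermann's function

fold-mono : ∀ {f} → f Preserves _≤_ ⟶ _≤_ → ∀ i {x y} → x ≤ y → fold x f i ≤ fold y f i
fold-mono f-mono zero    x≤y = x≤y
fold-mono f-mono (suc i) x≤y = f-mono (fold-mono f-mono i x≤y)

fold-inflationary : ∀ {f} → (∀ x → x ≤ f x) → ∀ i x → x ≤ fold x f i
fold-inflationary infl zero    x = ≤-refl
fold-inflationary infl (suc i) x = ≤-trans (fold-inflationary infl i x) (infl _)

fold-mono-count : ∀ {f} → (∀ x → x ≤ f x) → ∀ x {i j} → i ≤ j → fold x f i ≤ fold x f j
fold-mono-count {f} infl x i≤j = go (≤⇒≤′ i≤j)
  where
  go : ∀ {i j} → i ≤′ j → fold x f i ≤ fold x f j
  go (≤′-reflexive refl) = ≤-refl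
  go (≤′-step i≤′j) = ≤-trans (go i≤′j) (infl _)

fold-suc : ∀ i x → fold x suc i ≡ i + x
fold-suc zero    x = refl
fold-suc (suc i) x = cong suc (fold-suc i x)

-- Opaque because unfolding Ack during conversion checking is exponential.
opaque
  Ack : ℕ → ℕ → ℕ
  Ack zero    j = suc j
  Ack (suc k) j = fold j (Ack k) (suc j)

  n<Ack : ∀ k j → j < Ack k j
  n<Ack zero    j = ≤-refl
  n<Ack (suc k) j =
    ≤-<-trans (fold-inflationary (λ x → <⇒≤ (n<Ack k x)) j j) (n<Ack k _)

  Ack-mono : ∀ k → Ack k Preserves _≤_ ⟶ _≤_
  Ack-mono zero    a≤b = s≤s a≤b
  Ack-mono (suc k) {a} {b} a≤b =
    ≤-trans (fold-mono (Ack-mono k) (suc a) a≤b) (fold-mono-count (<⇒≤ ∘ n<Ack k) b (s≤s a≤b))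

  Ack-mono-< : ∀ k {a b} → a < b → Ack k a < Ack k b
  Ack-mono-< zero    a<b = s≤s a<b
  Ack-mono-< (suc k) {a} {b} a<b =
    <-≤-trans (≤-<-trans (fold-mono (Ack-mono k) (suc a) (<⇒≤ a<b)) (n<Ack k _))
              (fold-mono-count (<⇒≤ ∘ n<Ack k) b (s≤s a<b))

  Ack≤Ack-suc : ∀ k j → Ack k j ≤ Ack (suc k) j
  Ack≤Ack-suc k j = fold-mono-count (<⇒≤ ∘ n<Ack k) j {1} {suc j} (s≤s z≤n)

  Ack∘Ack≤Ack-suc : ∀ k {y} → 1 ≤ y → Ack k (Ack k y) ≤ Ack (suc k) y
  Ack∘Ack≤Ack-suc k {y} 1≤y = fold-mono-count (<⇒≤ ∘ n<Ack k) y {2} {suc y} (s≤s 1≤y)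

  fold-Ack≤Ack-suc : ∀ k {x y i} → x ≤ y → i ≤ suc y → fold x (Ack k) i ≤ Ack (suc k) y
  fold-Ack≤Ack-suc k {x} {y} {i} x≤y i≤1+y =
    ≤-trans (fold-mono (Ack-mono k) i x≤y) (fold-mono-count (<⇒≤ ∘ n<Ack k) y i≤1+y)

  Ack-1 : ∀ j → Ack 1 j ≡ suc (j + j)
  Ack-1 j = cong suc (fold-suc j j)

  Ack-zero : ∀ j → Ack 0 j ≡ suc j
  Ack-zero j = refl

  Ack-suc : ∀ k j → Ack (suc k) j ≡ fold j (Ack k) (suc j)
  Ack-suc k j = refl

n≤Ack : ∀ k x → x ≤ Ack k x
n≤Ack k x = <⇒≤ (n<Ack k x)

Ack-monoˡ : ∀ {k k′} j → k ≤ k′ → Ack k j ≤ Ack k′ j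
Ack-monoˡ {k} j k≤k′ = go (≤⇒≤′ k≤k′)
  where
  go : ∀ {k′} → k ≤′ k′ → Ack k j ≤ Ack k′ j
  go (≤′-reflexive refl) = ≤-refl
  go (≤′-step {k′} k≤′k′) = ≤-trans (go k≤′k′) (Ack≤Ack-suc k′ j)

fold-shift : ∀ {f : ℕ → ℕ} x i → fold (f x) f i ≡ fold x f (suc i)
fold-shift {f} x i = trans (sym (fold-+ x f i)) (cong (fold x f) (+-comm i 1))

Ack1-affine : ∀ z → 1 ≤ z → 2 * z + 1 ≤ Ack 1 z
Ack1-affine z _ =
  ≤-reflexive (trans (+-comm (2 * z) 1) (trans (cong (λ t → suc (z + t)) (+-identityʳ z)) (sym (Ack-1 z))))

Ack-affine : ∀ k a b → (∀ z → 1 ≤ z → a * z + b ≤ Ack k z) →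
             ∀ y → 1 ≤ y → (a * a) * y + (a * b + b) ≤ Ack (suc k) y
Ack-affine k a b hyp y 1≤y = begin
  a * a * y + (a * b + b)  ≡⟨ regroup a b y ⟩
  a * (a * y + b) + b      ≤⟨ +-monoˡ-≤ b (*-monoʳ-≤ a (hyp y 1≤y)) ⟩
  a * Ack k y + b          ≤⟨ hyp (Ack k y) (≤-trans 1≤y (n≤Ack k y)) ⟩
  Ack k (Ack k y)          ≤⟨ Ack∘Ack≤Ack-suc k 1≤y ⟩
  Ack (suc k) y            ∎
  where
  open ≤-Reasoning
  regroup : ∀ a b y → a * a * y + (a * b + b) ≡ a * (a * y + b) + b
  regroup = solve-∀

Ack4-affine : ∀ y → 1 ≤ y → 256 * y + 255 ≤ Ack 4 y
Ack4-affine = Ack-affine 3 16 15 (Ack-affine 2 4 3 (Ack-affine 1 2 1 Ack1-affine))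

2^i≤1+fold-Ack1 : ∀ i y → 2 ^ i ≤ suc (fold y (Ack 1) i)
2^i≤1+fold-Ack1 zero    y = s≤s z≤n
2^i≤1+fold-Ack1 (suc i) y = begin
  2 * 2 ^ i     ≤⟨ *-monoʳ-≤ 2 (2^i≤1+fold-Ack1 i y) ⟩
  2 * suc F     ≡⟨ double-suc F ⟩
  suc (suc (F + F)) ≡⟨ cong suc (sym (Ack-1 F)) ⟩
  suc (Ack 1 F) ∎
  where
  open ≤-Reasoning
  F = fold y (Ack 1) i
  double-suc : ∀ m → 2 * suc m ≡ suc (suc (m + m))
  double-suc = solve-∀

2^≤Ack2 : ∀ j → 2 ^ j ≤ Ack 2 j
2^≤Ack2 j = ≤-pred (begin
  suc (2 ^ j)   ≡⟨ +-comm 1 (2 ^ j) ⟩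
  2 ^ j + 1     ≤⟨ +-monoʳ-≤ (2 ^ j) (≤-trans (m^n>0 2 j) (m≤m+n (2 ^ j) 0)) ⟩
  2 ^ suc j     ≤⟨ 2^i≤1+fold-Ack1 (suc j) j ⟩
  suc (fold j (Ack 1) (suc j)) ≡⟨ cong suc (Ack-suc 1 j) ⟨
  suc (Ack 2 j) ∎)
  where open ≤-Reasoning

-- Bounding n by log** n

n<2^n : ∀ n → n < 2 ^ n
n<2^n zero    = s≤s z≤n
n<2^n (suc n) = ≤-trans (s≤s (n<2^n n))
  (≤-trans (≤-reflexive (+-comm 1 (2 ^ n))) (+-monoʳ-≤ (2 ^ n) (≤-trans (m^n>0 2 n) (m≤m+n (2 ^ n) 0))))

unlog : ℕ → ℕ
unlog r = 2 ^ (8 * 2 ^ r)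

unlog-pos : ∀ r → 1 ≤ unlog r
unlog-pos r = m^n>0 2 (8 * 2 ^ r)

unlog-inflationary : ∀ r → r ≤ unlog r
unlog-inflationary r =
  <⇒≤ (<-≤-trans (n<2^n r) (^-monoʳ-≤ 2 (≤-trans (<⇒≤ (n<2^n r)) (m≤n*m (2 ^ r) 8))))

unlog≤Ack2⁴ : ∀ r → unlog r ≤ fold r (Ack 2) 4
unlog≤Ack2⁴ r = begin
  2 ^ (8 * 2 ^ r)        ≡⟨ cong (2 ^_) (^-distribˡ-+-* 2 3 r) ⟨
  2 ^ (2 ^ (3 + r))      ≤⟨ ^-monoʳ-≤ 2 (2^≤Ack2 (3 + r)) ⟩
  2 ^ Ack 2 (3 + r)      ≤⟨ 2^≤Ack2 (Ack 2 (3 + r)) ⟩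
  Ack 2 (Ack 2 (3 + r))  ≤⟨ Ack-mono 2 (Ack-mono 2 3+r≤Ack2²r) ⟩
  Ack 2 (Ack 2 (Ack 2 (Ack 2 r))) ∎
  where
  open ≤-Reasoning
  3+r≤Ack2²r : 3 + r ≤ Ack 2 (Ack 2 r)
  3+r≤Ack2²r = begin
    3 + r                 ≤⟨ +-monoʳ-≤ 3 (≤-trans (n≤1+n r) (m≤n*m (suc r) 4)) ⟩
    3 + 4 * suc r         ≡⟨ +-comm 3 (4 * suc r) ⟩
    4 * suc r + 3         ≤⟨ Ack-affine 1 2 1 Ack1-affine (suc r) (s≤s z≤n) ⟩
    Ack 2 (suc r)         ≤⟨ Ack-mono 2 (n<Ack 2 r) ⟩
    Ack 2 (Ack 2 r)       ∎

[8h]^4-bound : ∀ h → h * 4096 ≤ (8 * h) ^ 4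
[8h]^4-bound zero      = z≤n
[8h]^4-bound h@(suc _) = begin
  h * 4096              ≡⟨ regroup h ⟩
  8 * h * 8 ^ 3         ≤⟨ *-monoʳ-≤ (8 * h) (^-monoˡ-≤ 3 (m≤m*n 8 h)) ⟩
  8 * h * (8 * h) ^ 3   ∎
  where
  open ≤-Reasoning
  regroup : ∀ h → h * 4096 ≡ 8 * h * 512
  regroup = solve-∀

-- The witnesses are a = 8 (r + 1), b = 1 and w = unlog r: then 2^a ≤ unlog r < 2w and (a / 8)⁴ > r.
lowerCut-unlog : ∀ j r x → ℕ→ℚ (fold r unlog j) ℚ.< x → LowerCut j x (ℕ→ℚ r)
lowerCut-unlog zero    r x lt = lt
lowerCut-unlog (suc j) r x lt =
  8 * suc r , 0 , ℕ→ℚ (unlog r) , ℕ→ℚ-mono-< (unlog-pos r) ,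
  ℕ→ℚ<[2w]^1 (2 ^ (8 * suc r)) (unlog r) exponent-bound ,
  ℕ→ℚ<[a/8]^4 r (8 * suc r) (<-≤-trans (*-monoˡ-< 4096 (n<1+n r)) ([8h]^4-bound (suc r))) ,
  lowerCut-unlog j (unlog r) x (subst (λ z → ℕ→ℚ z ℚ.< x) (sym (fold-shift r j)) lt)
  where
  exponent-bound : 2 ^ (8 * suc r) < 2 * unlog r
  exponent-bound = <-≤-trans
    (≤-<-trans (^-monoʳ-≤ 2 (*-monoʳ-≤ 8 (n<2^n r))) (m<m+n (unlog r) (unlog-pos r)))
    (≤-reflexive (cong (unlog r +_) (sym (+-identityʳ (unlog r)))))

unlog* : ℕ → ℕ
unlog* = fold 1 unlog

unlog*-mono : ∀ {j j′} → j ≤ j′ → unlog* j ≤ unlog* j′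
unlog*-mono = fold-mono-count unlog-inflationary 1

IsLogStar⇒≤unlog* : ∀ {x j} → IsLogStar x j → x ℚ.≤ ℕ→ℚ (unlog* j)
IsLogStar⇒≤unlog* {x} {j} (f^jx≤1 , _) = ℚ.≮⇒≥ (λ lt → f^jx≤1 (lowerCut-unlog j 1 x lt))

unlog** : ℕ → ℕ
unlog** zero    = 1
unlog** (suc k) = unlog* (8 * unlog** k)

unlog**-pos : ∀ k → 1 ≤ unlog** k
unlog**-pos zero    = ≤-refl
unlog**-pos (suc k) = unlog*-mono {0} {8 * unlog** k} z≤n

IsLogStarStar⇒≤unlog** : ∀ {x k} → IsLogStarStar x k → x ℚ.≤ ℕ→ℚ (unlog** k)
IsLogStarStar⇒≤unlog** (done x≤1) = x≤1
IsLogStarStar⇒≤unlog** (next {j = j} {k = k} _ logStar rest) =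
  ℚ.≤-trans (IsLogStar⇒≤unlog* logStar) (ℕ→ℚ-mono-≤ (unlog*-mono {j} {8 * h} (<⇒≤ j<8h)))
  where
  h = unlog** k
  j<8h : j < 8 * h
  j<8h = ≮⇒≥ λ 8h<1+j → ℚ.<-irrefl refl (ℚ.<-≤-trans
    (ℕ→ℚ<[a/8]^4 h (suc j) (≤-<-trans ([8h]^4-bound h) (^-monoˡ-< 4 8h<1+j)))
    (IsLogStarStar⇒≤unlog** rest))

unlog*≤Ack3 : ∀ t → unlog* t ≤ Ack 3 (t * 4 + 1)
unlog*≤Ack3 t =
  ≤-trans (unlog-iterate t 1) (fold-Ack≤Ack-suc 2 (m≤n+m 1 (t * 4)) (≤-trans (m≤m+n (t * 4) 1) (n≤1+n _)))
  where
  unlog-iterate : ∀ t r → fold r unlog t ≤ fold r (Ack 2) (t * 4)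
  unlog-iterate zero    r = ≤-refl
  unlog-iterate (suc t) r = begin
    unlog (fold r unlog t)                ≤⟨ unlog≤Ack2⁴ (fold r unlog t) ⟩
    fold (fold r unlog t) (Ack 2) 4       ≤⟨ fold-mono (Ack-mono 2) 4 (unlog-iterate t r) ⟩
    fold (fold r (Ack 2) (t * 4)) (Ack 2) 4 ≡⟨ fold-+ r (Ack 2) 4 {t * 4} ⟨
    fold r (Ack 2) (suc t * 4)            ∎
    where open ≤-Reasoning

unlog**<Ack : ∀ k → unlog** k < Ack (5 + k) 1
unlog**<Ack zero    = n<Ack 5 1
unlog**<Ack (suc k) = begin-strict
  unlog* (8 * h)               ≤⟨ unlog*≤Ack3 (8 * h) ⟩
  Ack 3 (8 * h * 4 + 1)        ≤⟨ Ack-mono 3 (≤-trans 32h+1≤256h+255 (Ack4-affine h 1≤h)) ⟩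
  Ack 3 (Ack 4 h)              ≤⟨ Ack-monoˡ (Ack 4 h) (n≤1+n 3) ⟩
  Ack 4 (Ack 4 h)              ≤⟨ Ack∘Ack≤Ack-suc 4 1≤h ⟩
  Ack 5 h                      ≤⟨ Ack-monoˡ h (m≤m+n 5 k) ⟩
  Ack (5 + k) h                <⟨ Ack-mono-< (5 + k) (unlog**<Ack k) ⟩
  Ack (5 + k) (Ack (5 + k) 1)  ≤⟨ Ack∘Ack≤Ack-suc (5 + k) ≤-refl ⟩
  Ack (6 + k) 1                ∎
  where
  open ≤-Reasoning
  h = unlog** k
  1≤h = unlog**-pos k
  32h+1≤256h+255 : 8 * h * 4 + 1 ≤ 256 * h + 255
  32h+1≤256h+255 = +-mono-≤ (≤-trans (≤-reflexive (regroup h)) (*-monoˡ-≤ h (m≤m+n 32 224))) (s≤s z≤n)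
    where
    regroup : ∀ h → 8 * h * 4 ≡ 32 * h
    regroup = solve-∀

IsLogStarStar⇒<Ack : ∀ {n L} → 2 ≤ n → IsLogStarStar (ℕ→ℚ n) L → 1 ≤ L × n < Ack (5 + L) 1
IsLogStarStar⇒<Ack {L = zero}  2≤n (done n≤1) = ⊥-elim (<⇒≱ 2≤n (ℕ→ℚ-cancel-≤ n≤1))
IsLogStarStar⇒<Ack {L = suc L} 2≤n logStar² =
  s≤s z≤n , ≤-<-trans (ℕ→ℚ-cancel-≤ (IsLogStarStar⇒≤unlog** logStar²)) (unlog**<Ack (suc L))

-- Finite sums

sum-mono-≤ : ∀ {n} {f g : Fin n → ℕ} → (∀ i → f i ≤ g i) → sum f ≤ sum g
sum-mono-≤ {zero}  f≤g = z≤n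
sum-mono-≤ {suc n} f≤g = +-mono-≤ (f≤g zero) (sum-mono-≤ (λ i → f≤g (suc i)))

sum-mono-< : ∀ {n} {f g : Fin n → ℕ} → (∀ i → f i ≤ g i) → ∀ j → f j < g j → sum f < sum g
sum-mono-< f≤g zero    fj<gj = +-mono-<-≤ fj<gj (sum-mono-≤ (λ i → f≤g (suc i)))
sum-mono-< f≤g (suc j) fj<gj = +-mono-≤-< (f≤g zero) (sum-mono-< (λ i → f≤g (suc i)) j fj<gj)

sum-bound : ∀ {n} {f : Fin n → ℕ} c → (∀ i → f i ≤ c) → sum f ≤ n * c
sum-bound {zero}  c f≤c = z≤n
sum-bound {suc n} c f≤c = +-mono-≤ (f≤c zero) (sum-bound c (λ i → f≤c (suc i)))

sum-exchange : ∀ {n} (f f′ : Fin n → ℕ) j → (∀ i → i ≢ j → f′ i ≡ f i) → sum f′ + f j ≡ sum f + f′ j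
sum-exchange {suc n} f f′ j agree = begin
  sum f′ + f j                       ≡⟨ cong (_+ f j) (sum-remove {i = j} f′) ⟩
  f′ j + sum (removeAt f′ j) + f j   ≡⟨ cong (λ s → f′ j + s + f j) rest ⟩
  f′ j + sum (removeAt f j) + f j    ≡⟨ swap (f′ j) (sum (removeAt f j)) (f j) ⟩
  f j + sum (removeAt f j) + f′ j    ≡⟨ cong (_+ f′ j) (sum-remove {i = j} f) ⟨
  sum f + f′ j                       ∎
  where
  open ≡-Reasoning
  rest : sum (removeAt f′ j) ≡ sum (removeAt f j)
  rest = sum-cong-≗ (λ i → agree (punchIn j i) (punchInᵢ≢i j i))
  swap : ∀ a b c → a + b + c ≡ c + b + a
  swap = solve-∀

sum-mono-except : ∀ {n} {f g : Fin n → ℕ} j c → (∀ i → i ≢ j → f i ≤ g i) → f j ≤ g j + c → sum f ≤ sum g + c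
sum-mono-except {suc n} {f} {g} j c f≤g fj≤gj+c = begin
  sum f                                ≡⟨ sum-remove {i = j} f ⟩
  f j + sum (removeAt f j)             ≤⟨ +-mono-≤ fj≤gj+c (sum-mono-≤ (λ i → f≤g (punchIn j i) (punchInᵢ≢i j i))) ⟩
  g j + c + sum (removeAt g j)         ≡⟨ swap (g j) c _ ⟩
  g j + sum (removeAt g j) + c         ≡⟨ cong (_+ c) (sum-remove {i = j} g) ⟨
  sum g + c                            ∎
  where
  open ≤-Reasoning
  swap : ∀ a b c → a + b + c ≡ a + c + b
  swap = solve-∀

upd-same : ∀ {n} {A : Set} (f : Fin n → A) i v → upd f i v i ≡ v
upd-same f i v with i ≟ i
... | yes _   = refl
... | no i≢i = contradiction refl i≢i

upd-other : ∀ {n} {A : Set} (f : Fin n → A) i v {j} → j ≢ i → upd f i v j ≡ f j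
upd-other f i v {j} j≢i with j ≟ i
... | yes j≡i = contradiction j≡i j≢i
... | no _    = refl

map-upd-fresh : ∀ {n} (f : Fin n → ℕ) {i} v {xs} → All (i ≢_) xs → List.map (upd f i v) xs ≡ List.map f xs
map-upd-fresh f v []           = refl
map-upd-fresh f v (i≢x ∷ i∉xs) = cong₂ _∷_ (upd-other f _ v (i≢x ∘ sym)) (map-upd-fresh f v i∉xs)

∑ : ∀ {n} → (Fin n → ℕ) → List (Fin n) → ℕ
∑ f xs = sumᴸ (List.map f xs)

sum-exchange-list : ∀ {n} (f g : Fin n → ℕ) {ps} → Unique ps → (∀ x → x ∉ ps → f x ≡ g x) →
                    sum f + ∑ g ps ≡ sum g + ∑ f ps
sum-exchange-list f g {[]} [] f≡g = cong (_+ 0) (sum-cong-≗ (λ x → f≡g x λ ()))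
sum-exchange-list f g {q ∷ qs} (q∉qs ∷ unique) f≡g = begin
  sum f + (g q + ∑ g qs)   ≡⟨ +-assoc (sum f) (g q) (∑ g qs) ⟨
  sum f + g q + ∑ g qs     ≡⟨ cong (λ s → s + ∑ g qs) (sym exchange-at-q) ⟩
  sum f₁ + f q + ∑ g qs    ≡⟨ swap (sum f₁) (f q) (∑ g qs) ⟩
  sum f₁ + ∑ g qs + f q    ≡⟨ cong (_+ f q) (sum-exchange-list f₁ g unique f₁≡g) ⟩
  sum g + ∑ f₁ qs + f q    ≡⟨ cong (λ s → sum g + sumᴸ s + f q) (map-upd-fresh f (g q) q∉qs) ⟩
  sum g + ∑ f qs + f q     ≡⟨ swap′ (sum g) (∑ f qs) (f q) ⟩
  sum g + (f q + ∑ f qs)   ∎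
  where
  open ≡-Reasoning
  f₁ = upd f q (g q)
  exchange-at-q : sum f₁ + f q ≡ sum f + g q
  exchange-at-q = trans (sum-exchange f f₁ q (λ x → upd-other f q (g q))) (cong (sum f +_) (upd-same f q (g q)))
  f₁≡g : ∀ x → x ∉ qs → f₁ x ≡ g x
  f₁≡g x x∉qs with x ≟ q
  ... | yes refl = refl
  ... | no x≢q   = f≡g x λ { (here x≡q) → x≢q x≡q ; (there x∈qs) → x∉qs x∈qs }
  swap : ∀ a b c → a + b + c ≡ a + c + b
  swap = solve-∀
  swap′ : ∀ a b c → a + b + c ≡ a + (c + b)
  swap′ = solve-∀

-- Progress towards the parent's rank

indicator : ∀ {P : Set} → Dec P → ℕ
indicator (yes _) = 1
indicator (no _)  = 0

indicator-mono : ∀ {P Q : Set} (p? : Dec P) (q? : Dec Q) → (P → Q) → indicator p? ≤ indicator q?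
indicator-mono (yes p) (yes _) P→Q = ≤-refl
indicator-mono (yes p) (no ¬q) P→Q = contradiction (P→Q p) ¬q
indicator-mono (no _)  q?      P→Q = z≤n

indicator-< : ∀ {P Q : Set} (p? : Dec P) (q? : Dec Q) → ¬ P → Q → indicator p? < indicator q?
indicator-< (yes p) q?      ¬p q = contradiction p ¬p
indicator-< (no _)  (yes _) ¬p q = ≤-refl
indicator-< (no _)  (no ¬q) ¬p q = contradiction q ¬q

indicator≤1 : ∀ {P : Set} (p? : Dec P) → indicator p? ≤ 1
indicator≤1 (yes _) = ≤-refl
indicator≤1 (no _)  = z≤n

reaches? : ∀ r r′ k i → Dec (fold r (Ack k) (suc i) ≤ r′)
reaches? r r′ k i = fold r (Ack k) (suc i) ≤? r′

progress : ℕ → ℕ → ℕ → ℕ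
progress K r r′ = sum λ (k : Fin K) → sum λ (i : Fin r) → indicator (reaches? r r′ (toℕ k) (toℕ i))

reaches-mono : ∀ r {r′ R} k i → r′ ≤ R → indicator (reaches? r r′ k i) ≤ indicator (reaches? r R k i)
reaches-mono r k i r′≤R = indicator-mono (reaches? r _ k i) (reaches? r _ k i) (λ le → ≤-trans le r′≤R)

progress-mono : ∀ K r {r′ R} → r′ ≤ R → progress K r r′ ≤ progress K r R
progress-mono K r r′≤R = sum-mono-≤ {K} λ k → sum-mono-≤ {r} λ i → reaches-mono r (toℕ k) (toℕ i) r′≤R

progress≤ : ∀ K r r′ → progress K r r′ ≤ K * r
progress≤ K r r′ = sum-bound {K} r λ k →
  ≤-trans (sum-bound {r} 1 (λ i → indicator≤1 (reaches? r r′ (toℕ k) (toℕ i)))) (≤-reflexive (*-identityʳ r))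

progress-< : ∀ K r {r′ R k i} → r′ ≤ R → k < K → i < r →
             r′ < fold r (Ack k) (suc i) → fold r (Ack k) (suc i) ≤ R → progress K r r′ < progress K r R
progress-< K r {r′} {R} {k} {i} r′≤R k<K i<r fresh reached =
  sum-mono-< {K} (λ k → sum-mono-≤ {r} λ i → reaches-mono r (toℕ k) (toℕ i) r′≤R) k′
    (sum-mono-< {r} (λ i → reaches-mono r (toℕ k′) (toℕ i) r′≤R) i′
      (indicator-< (reaches? r r′ (toℕ k′) (toℕ i′)) (reaches? r R (toℕ k′) (toℕ i′)) not-before now))
  where
  k′ = fromℕ< k<K
  i′ = fromℕ< i<r
  not-before : ¬ fold r (Ack (toℕ k′)) (suc (toℕ i′)) ≤ r′
  not-before rewrite toℕ-fromℕ< k<K | toℕ-fromℕ< i<r = <⇒≱ fresh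
  now : fold r (Ack (toℕ k′)) (suc (toℕ i′)) ≤ R
  now rewrite toℕ-fromℕ< k<K | toℕ-fromℕ< i<r = reached

record Level (K r r′ : ℕ) : Set where
  field
    index   : ℕ
    index<K : index < K
    reached : Ack index r ≤ r′
    maximal : ∀ {k} → index < k → k < K → r′ < Ack k r

level : ∀ K {r r′} → 0 < K → Ack 0 r ≤ r′ → Level K r r′
level (suc zero) _ Ack0≤r′ = record
  { index = 0 ; index<K = s≤s z≤n ; reached = Ack0≤r′
  ; maximal = λ 0<k k<1 → contradiction (≤-trans 0<k (≤-pred k<1)) λ () }
level (suc (suc K)) {r} {r′} _ Ack0≤r′ = extend (level (suc K) (s≤s z≤n) Ack0≤r′) (Ack (suc K) r ≤? r′)
  where
  extend : Level (suc K) r r′ → Dec (Ack (suc K) r ≤ r′) → Level (suc (suc K)) r r′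
  extend _   (yes reached) = record
    { index = suc K ; index<K = ≤-refl ; reached = reached
    ; maximal = λ K<k k<K → contradiction k<K (<⇒≱ (s≤s K<k)) }
  extend lvl (no unreached) = record
    { index = index ; index<K = m<n⇒m<1+n index<K ; reached = reached ; maximal = maximal′ }
    where
    open Level lvl
    maximal′ : ∀ {k} → index < k → k < suc (suc K) → r′ < Ack k r
    maximal′ {k} idx<k k<2+K with m≤n⇒m<n∨m≡n (≤-pred k<2+K)
    ... | inj₁ k<1+K = maximal idx<k k<1+K
    ... | inj₂ refl  = ≰⇒> unreached

last-below : ∀ (f : ℕ → ℕ) x y m → f x ≤ y →
             Σ ℕ λ j → fold x f j ≤ y × (j ≡ suc m ⊎ (j < suc m × y < fold x f (suc j)))
last-below f x y zero    fx≤y = 1 , fx≤y , inj₁ refl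
last-below f x y (suc m) fx≤y with last-below f x y m fx≤y
... | j , fʲx≤y , inj₂ (j<1+m , y<) = j , fʲx≤y , inj₂ (m<n⇒m<1+n j<1+m , y<)
... | j , fʲx≤y , inj₁ refl with fold x f (suc j) ≤? y
...   | yes fʲ⁺¹x≤y = suc j , fʲ⁺¹x≤y , inj₁ refl
...   | no fʲ⁺¹x≰y  = j , fʲx≤y , inj₂ (≤-refl , ≰⇒> fʲ⁺¹x≰y)

-- R ≥ Ack k r′ is reached by one more iterate of Ack k from r or, if all r + 1 iterates stay
-- below r′, by Ack (1 + k) r; either way a new pair is counted.
progress-increases : ∀ K {r r′ R} → 1 ≤ r → r′ ≤ R → R < Ack K r → (lvl : Level K r r′) →
                     Ack (Level.index lvl) r′ ≤ R → progress K r r′ < progress K r R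
progress-increases K {r@(suc r₀)} {r′} {R} 1≤r r′≤R R<AckKr lvl Ackₖr′≤R =
  from-last-iterate (last-below (Ack k) r r′ r₀ reached)
  where
  open Level lvl renaming (index to k; index<K to k<K)
  next-iterate≤R : ∀ {j} → fold r (Ack k) j ≤ r′ → fold r (Ack k) (suc j) ≤ R
  next-iterate≤R fʲr≤r′ = ≤-trans (Ack-mono k fʲr≤r′) Ackₖr′≤R
  next-level : Ack (suc k) r ≤ R → progress K r r′ < progress K r R
  next-level Ack₁₊ₖr≤R with m≤n⇒m<n∨m≡n k<K
  ... | inj₁ 1+k<K = progress-< K r {k = suc k} {i = 0} r′≤R 1+k<K 1≤r (maximal ≤-refl 1+k<K) Ack₁₊ₖr≤R
  ... | inj₂ 1+k≡K = contradiction (subst (λ K → R < Ack K r) (sym 1+k≡K) R<AckKr) (≤⇒≯ Ack₁₊ₖr≤R)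
  from-last-iterate : (Σ ℕ λ j → fold r (Ack k) j ≤ r′ × (j ≡ r ⊎ (j < r × r′ < fold r (Ack k) (suc j)))) →
                      progress K r r′ < progress K r R
  from-last-iterate (j , fʲr≤r′ , inj₂ (j<r , r′<fʲ⁺¹r)) =
    progress-< K r r′≤R k<K j<r r′<fʲ⁺¹r (next-iterate≤R {j} fʲr≤r′)
  from-last-iterate (_ , fʳr≤r′ , inj₁ refl) =
    next-level (subst (_≤ R) (sym (Ack-suc k r)) (next-iterate≤R {r} fʳr≤r′))

-- Union by size

opaque
  rank : ℕ → ℕ
  rank = ⌊log₂_⌋

  rank-double : ∀ {a b} → 1 ≤ a → 2 * a ≤ b → rank a < rank b
  rank-double {suc a} _ 2a≤b = ≤-trans (≤-reflexive (sym (⌊log₂[2*b]⌋≡1+⌊log₂b⌋ (suc a)))) (⌊log₂⌋-mono-≤ 2a≤b)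

  rank≤ : ∀ {a} u → a ≤ 2 ^ u → rank a ≤ u
  rank≤ u a≤2ᵘ = ≤-trans (⌊log₂⌋-mono-≤ a≤2ᵘ) (≤-reflexive (⌊log₂[2^n]⌋≡n u))

  rank-union : ∀ {a b} → 1 ≤ a → b ≤ a → rank (a + b) ≤ suc (rank a)
  rank-union {a@(suc _)} _ b≤a =
    ≤-trans (⌊log₂⌋-mono-≤ (≤-trans (+-monoʳ-≤ a b≤a) (≤-reflexive (cong (a +_) (sym (+-identityʳ a))))))
            (≤-reflexive (⌊log₂[2*b]⌋≡1+⌊log₂b⌋ a))

  rank-mono : ∀ {a b} → a ≤ b → rank a ≤ rank b
  rank-mono = ⌊log₂⌋-mono-≤

  rank-1 : rank 1 ≡ 0
  rank-1 = refl

-- u bounds the number of unions performed so far.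
record Balanced {n} (s : State n) (u : ℕ) : Set where
  field
    doubling : ∀ x → parent s x ≢ x → 2 * size s x ≤ size s (parent s x)
    size-pos : ∀ x → 1 ≤ size s x
    size≤2ᵘ  : ∀ x → size s x ≤ 2 ^ u

module PathProperties {n} (P : Fin n → Fin n) (S : Fin n → ℕ)
  (doubling : ∀ x → P x ≢ x → 2 * S x ≤ S (P x)) (size-pos : ∀ x → 1 ≤ S x) where

  parent-larger : ∀ x → P x ≢ x → S x < S (P x)
  parent-larger x Px≢x = <-≤-trans (m<m+n (S x) (size-pos x))
    (≤-trans (≤-reflexive (cong (S x +_) (sym (+-identityʳ (S x))))) (doubling x Px≢x))

  path-end : ∀ {p ps r} → Path P p ps r → P r ≡ r × S p ≤ S r
  path-end (atRoot Pr≡r)     = Pr≡r , ≤-refl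
  path-end (up {p} Pp≢p path) =
    proj₁ (path-end path) , ≤-trans (<⇒≤ (parent-larger p Pp≢p)) (proj₂ (path-end path))

  path-member : ∀ {p ps r} → Path P p ps r → ∀ {x} → x ∈ ps → x ≡ r ⊎ (P x ≢ x × S (P x) ≤ S r)
  path-member (atRoot _)       (here refl)  = inj₁ refl
  path-member (up Pp≢p path)   (here refl)  = inj₂ (Pp≢p , proj₂ (path-end path))
  path-member (up _ path)      (there x∈ps) = path-member path x∈ps

  path-start-smallest : ∀ {p ps r} → Path P p ps r → ∀ {x} → x ∈ ps → S p ≤ S x
  path-start-smallest (atRoot _)         (here refl)  = ≤-refl
  path-start-smallest (up _ _)           (here refl)  = ≤-refl
  path-start-smallest (up {p} Pp≢p path) (there x∈ps) =
    ≤-trans (<⇒≤ (parent-larger p Pp≢p)) (path-start-smallest path x∈ps)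

  path-unique : ∀ {p ps r} → Path P p ps r → Unique ps
  path-unique (atRoot _)         = [] ∷ []
  path-unique (up {p} Pp≢p path) =
    ¬Any⇒All¬ _ (λ p∈ps → <⇒≱ (parent-larger p Pp≢p) (path-start-smallest path p∈ps)) ∷ path-unique path

compress-on-path : ∀ {n} (P : Fin n → Fin n) ps r {x} → x ∈ ps → compress P ps r x ≡ r
compress-on-path {n} P ps r {x} x∈ps with x ∈? ps
  where open DecMembership (_≟_ {n})
... | yes _     = refl
... | no x∉ps   = contradiction x∈ps x∉ps

compress-off-path : ∀ {n} (P : Fin n → Fin n) ps r {x} → x ∉ ps → compress P ps r x ≡ P x
compress-off-path {n} P ps r {x} x∉ps with x ∈? ps
  where open DecMembership (_≟_ {n})
... | yes x∈ps  = contradiction x∈ps x∉ps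
... | no _      = refl

balanced-compress : ∀ {n} {s : State n} {u p ps r} → Balanced s u → Path (parent s) p ps r →
                    Balanced (st (compress (parent s) ps r) (size s)) u
balanced-compress {n} {s} {u} {p} {ps} {r} bal path = record
  { doubling = λ x → doubling′ x (x ∈? ps) ; size-pos = size-pos ; size≤2ᵘ = size≤2ᵘ }
  where
  open Balanced bal
  open PathProperties (parent s) (size s) doubling size-pos
  open DecMembership (_≟_ {n}) using (_∈?_)
  P′ = compress (parent s) ps r
  doubling′ : ∀ x → Dec (x ∈ ps) → P′ x ≢ x → 2 * size s x ≤ size s (P′ x)
  doubling′ x (no x∉ps) moved rewrite compress-off-path (parent s) ps r x∉ps = doubling x moved
  doubling′ x (yes x∈ps) moved rewrite compress-on-path (parent s) ps r x∈ps with path-member path x∈ps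
  ... | inj₁ refl                 = contradiction refl moved
  ... | inj₂ (Px≢x , SPx≤Sr)     = ≤-trans (doubling x Px≢x) SPx≤Sr

module Union {n} {s : State n} {u} (bal : Balanced s u) (w l : Fin n)
  (w-root : parent s w ≡ w) (l-root : parent s l ≡ l) (w≢l : w ≢ l) (l≤w : size s l ≤ size s w) where

  open Balanced bal
  P = parent s
  S = size s
  P′ = upd P l w
  S′ = upd S w (S w + S l)

  size-grows : ∀ y → S y ≤ S′ y
  size-grows y with y ≟ w
  ... | yes refl = m≤m+n (S y) (S l)
  ... | no _     = ≤-refl

  balanced-union : Balanced (st P′ S′) (suc u)
  balanced-union = record
    { doubling = λ x → doubling′ x (x ≟ l)
    ; size-pos = λ x → ≤-trans (size-pos x) (size-grows x)
    ; size≤2ᵘ  = λ x → size≤2ᵘ′ x (x ≟ w) }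
    where
    l≢w : l ≢ w
    l≢w = w≢l ∘ sym
    doubling′ : ∀ x → Dec (x ≡ l) → P′ x ≢ x → 2 * S′ x ≤ S′ (P′ x)
    doubling′ x (yes refl) _ rewrite upd-same P l w | upd-same S w (S w + S l) | upd-other S w (S w + S l) l≢w =
      ≤-trans (≤-reflexive (cong (S l +_) (+-identityʳ (S l)))) (+-monoˡ-≤ (S l) l≤w)
    doubling′ x (no x≢l) moved rewrite upd-other P l w x≢l =
      subst (λ a → 2 * a ≤ S′ (P x)) (sym (upd-other S w _ x≢w)) (≤-trans (doubling x moved) (size-grows (P x)))
      where
      x≢w : x ≢ w
      x≢w refl = moved w-root
    size≤2ᵘ′ : ∀ x → Dec (x ≡ w) → S′ x ≤ 2 ^ suc u
    size≤2ᵘ′ x (yes refl) rewrite upd-same S w (S w + S l) =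
      ≤-trans (+-mono-≤ (size≤2ᵘ w) (size≤2ᵘ l)) (≤-reflexive (cong (2 ^ u +_) (sym (+-identityʳ (2 ^ u)))))
    size≤2ᵘ′ x (no x≢w) rewrite upd-other S w (S w + S l) x≢w = ≤-trans (size≤2ᵘ x) (m≤m+n (2 ^ u) _)

add-charge : ∀ {a′ a b′ b l d e} → suc a′ ≤ a + d → b′ + l ≤ b + e → a′ + b′ + suc l ≤ a + b + (d + e)
add-charge {a′} {a} {b′} {b} {l} {d} {e} h₁ h₂ = begin
  a′ + b′ + suc l       ≡⟨ regroup₁ a′ b′ l ⟩
  suc a′ + (b′ + l)     ≤⟨ +-mono-≤ h₁ h₂ ⟩
  a + d + (b + e)       ≡⟨ regroup₂ a d b e ⟩
  a + b + (d + e)       ∎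
  where
  open ≤-Reasoning
  regroup₁ : ∀ a′ b′ l → a′ + b′ + suc l ≡ suc a′ + (b′ + l)
  regroup₁ = solve-∀
  regroup₂ : ∀ a d b e → a + d + (b + e) ≡ a + b + (d + e)
  regroup₂ = solve-∀

-- The potential

module Potential (K : ℕ) (0<K : 0 < K) where

  credit : ∀ {n} → (Fin n → ℕ) → Fin n → Fin n → ℕ
  credit S x y with y ≟ x
  ... | yes _ = 0
  ... | no _  = progress K (rank (S x)) (rank (S y))

  φ : ∀ {n} → (Fin n → Fin n) → (Fin n → ℕ) → Fin n → ℕ
  φ P S x = K * rank (S x) ∸ credit S x (P x)

  Φ : ∀ {n} → State n → ℕ
  Φ s = sum (φ (parent s) (size s))

  φ≤ : ∀ {n} (P : Fin n → Fin n) S x → φ P S x ≤ K * rank (S x)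
  φ≤ P S x = m∸n≤m (K * rank (S x)) (credit S x (P x))

  φ-root : ∀ {n} (P : Fin n → Fin n) S {x} → P x ≡ x → φ P S x ≡ K * rank (S x)
  φ-root P S {x} Px≡x rewrite Px≡x with x ≟ x
  ... | yes _  = refl
  ... | no x≢x = contradiction refl x≢x

  φ-nonroot : ∀ {n} (P : Fin n → Fin n) S {x y} → P x ≡ y → y ≢ x →
              φ P S x ≡ K * rank (S x) ∸ progress K (rank (S x)) (rank (S y))
  φ-nonroot P S {x} {y} refl y≢x with y ≟ x
  ... | yes y≡x = contradiction y≡x y≢x
  ... | no _    = refl

  φ-parent-cong : ∀ {n} (P P′ : Fin n → Fin n) S {x} → P′ x ≡ P x → φ P′ S x ≡ φ P S x
  φ-parent-cong P P′ S {x} P′x≡Px = cong (λ y → K * rank (S x) ∸ credit S x y) P′x≡Px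

  credit-mono : ∀ {n} (S S′ : Fin n → ℕ) x y → S′ x ≡ S x → rank (S y) ≤ rank (S′ y) → credit S x y ≤ credit S′ x y
  credit-mono S S′ x y S′x≡Sx rank≤ with y ≟ x
  ... | yes _ = z≤n
  ... | no _ rewrite S′x≡Sx = progress-mono K (rank (S x)) rank≤

  φ-anti : ∀ {n} (P : Fin n → Fin n) {S S′} x → S′ x ≡ S x → rank (S (P x)) ≤ rank (S′ (P x)) → φ P S′ x ≤ φ P S x
  φ-anti P {S} {S′} x S′x≡Sx rank≤ rewrite S′x≡Sx =
    ∸-monoʳ-≤ (K * rank (S x)) (credit-mono S S′ x (P x) S′x≡Sx rank≤)

  module Compression {n} (P : Fin n → Fin n) (S : Fin n → ℕ)
    (doubling : ∀ x → P x ≢ x → 2 * S x ≤ S (P x)) (size-pos : ∀ x → 1 ≤ S x)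
    (rank<Ack : ∀ x → rank (S x) < Ack K 1) (P′ : Fin n → Fin n) where

    open PathProperties P S doubling size-pos

    φ₀ φ₁ : Fin n → ℕ
    φ₀ = φ P S
    φ₁ = φ P′ S

    rank-parent : ∀ x → P x ≢ x → rank (S x) < rank (S (P x))
    rank-parent x Px≢x = rank-double (size-pos x) (doubling x Px≢x)

    level-of : ∀ x → P x ≢ x → Level K (rank (S x)) (rank (S (P x)))
    level-of x Px≢x = level K 0<K (subst (_≤ rank (S (P x))) (sym (Ack-zero _)) (rank-parent x Px≢x))

    ∑-unchanged : ∀ xs → (∀ {x} → x ∈ xs → P′ x ≡ P x) → ∑ φ₁ xs ≡ ∑ φ₀ xs
    ∑-unchanged []       _    = refl
    ∑-unchanged (x ∷ xs) same = cong₂ _+_ (φ-parent-cong P P′ S (same (here refl))) (∑-unchanged xs (same ∘ there))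

    -- M is the largest level met so far along the path. A node of level at most M pays for its
    -- step by a strict drop of potential; any other node raises M, which happens fewer than K times.
    charge : ∀ {h hs r} → Path P h hs r → P h ≢ h → 1 ≤ rank (S h) → (∀ {x} → x ∈ hs → P′ x ≡ r) →
             Σ ℕ λ M → M < K × Ack M (rank (S h)) ≤ rank (S r) × ∑ φ₁ hs + length hs ≤ ∑ φ₀ hs + (2 + M)
    charge (atRoot Ph≡h) Ph≢h _ _ = contradiction Ph≡h Ph≢h
    charge {h} (up _ (atRoot PPh≡Ph)) Ph≢h _ to-r =
      index , index<K , reached ,
      ≤-trans (≤-reflexive (cong (_+ 2) (∑-unchanged (h ∷ P h ∷ []) same))) (+-monoʳ-≤ _ (m≤m+n 2 index))
      where
      open Level (level-of h Ph≢h)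
      same : ∀ {x} → x ∈ h ∷ P h ∷ [] → P′ x ≡ P x
      same (here refl)         = to-r (here refl)
      same (there (here refl)) = trans (to-r (there (here refl))) (sym PPh≡Ph)
      same (there (there ()))
    charge {h} {_ ∷ hs} {r} (up _ rest@(up PPh≢Ph _)) Ph≢h 1≤rh to-r =
      extend (charge rest PPh≢Ph (≤-trans 1≤rh (<⇒≤ (rank-parent h Ph≢h))) (to-r ∘ there))
      where
      open Level (level-of h Ph≢h) renaming (index to k; index<K to k<K)
      rh = rank (S h)
      rPh = rank (S (P h))
      rr = rank (S r)
      rPh≤rr : rPh ≤ rr
      rPh≤rr = rank-mono (proj₂ (path-end rest))
      r≢h : r ≢ h
      r≢h refl = Ph≢h (proj₁ (path-end rest))
      φ₀h : φ₀ h ≡ K * rh ∸ progress K rh rPh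
      φ₀h = φ-nonroot P S refl Ph≢h
      φ₁h : φ₁ h ≡ K * rh ∸ progress K rh rr
      φ₁h = φ-nonroot P′ S (to-r (here refl)) r≢h
      extend : (Σ ℕ λ M → M < K × Ack M rPh ≤ rr × ∑ φ₁ hs + length hs ≤ ∑ φ₀ hs + (2 + M)) →
               Σ ℕ λ M → M < K × Ack M rh ≤ rr × ∑ φ₁ (h ∷ hs) + length (h ∷ hs) ≤ ∑ φ₀ (h ∷ hs) + (2 + M)
      extend (M′ , M′<K , AckM′rPh≤rr , sum′) with k ≤? M′
      ... | yes k≤M′ =
        M′ , M′<K , ≤-trans (Ack-mono M′ (<⇒≤ (rank-parent h Ph≢h))) AckM′rPh≤rr ,
        add-charge {d = 0} {e = 2 + M′} paid sum′
        where
        gains : progress K rh rPh < progress K rh rr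
        gains = progress-increases K 1≤rh rPh≤rr (<-≤-trans (rank<Ack r) (Ack-mono K 1≤rh)) (level-of h Ph≢h)
                  (≤-trans (Ack-monoˡ rPh k≤M′) AckM′rPh≤rr)
        paid : suc (φ₁ h) ≤ φ₀ h + 0
        paid = subst₂ (λ a b → suc a ≤ b) (sym φ₁h) (trans (sym φ₀h) (sym (+-identityʳ _)))
                 (∸-monoʳ-< gains (progress≤ K rh rr))
      ... | no k≰M′ =
        k , k<K , ≤-trans reached rPh≤rr ,
        ≤-trans (add-charge {d = 1} {e = 2 + M′} raised sum′) (+-monoʳ-≤ _ (s≤s (s≤s (≰⇒> k≰M′))))
        where
        raised : suc (φ₁ h) ≤ φ₀ h + 1
        raised = subst₂ (λ a b → suc a ≤ b) (sym φ₁h) (trans (cong suc (sym φ₀h)) (+-comm 1 _))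
                   (s≤s (∸-monoʳ-≤ (K * rh) (progress-mono K rh rPh≤rr)))

    charge-bound : ∀ {M} → M < K → 3 + M ≤ K + 3
    charge-bound M<K = ≤-trans (+-monoʳ-≤ 3 (<⇒≤ M<K)) (≤-reflexive (+-comm 3 K))

    -- Only the first node of a path can have rank 0.
    find-charge : ∀ {p ps r} → Path P p ps r → (∀ {x} → x ∈ ps → P′ x ≡ r) →
                  ∑ φ₁ ps + length ps ≤ ∑ φ₀ ps + (K + 3)
    find-charge (atRoot Pr≡r) to-r =
      ≤-trans (≤-reflexive (cong (_+ 1) (∑-unchanged (_ ∷ []) same))) (+-monoʳ-≤ _ (≤-trans (s≤s z≤n) (m≤n+m 3 K)))
      where
      same : ∀ {x} → x ∈ _ ∷ [] → P′ x ≡ P x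
      same (here refl) = trans (to-r (here refl)) (sym Pr≡r)
      same (there ())
    find-charge {p} (up _ (atRoot PPp≡Pp)) to-r =
      ≤-trans (≤-reflexive (cong (_+ 2) (∑-unchanged (p ∷ P p ∷ []) same)))
              (+-monoʳ-≤ _ (≤-trans (s≤s (s≤s z≤n)) (m≤n+m 3 K)))
      where
      same : ∀ {x} → x ∈ p ∷ P p ∷ [] → P′ x ≡ P x
      same (here refl)         = to-r (here refl)
      same (there (here refl)) = trans (to-r (there (here refl))) (sym PPp≡Pp)
      same (there (there ()))
    find-charge {p} path@(up Pp≢p rest@(up PPp≢Pp _)) to-r with 1 ≤? rank (S p)
    ... | yes 1≤rp =
      let (M , M<K , _ , bound) = charge path Pp≢p 1≤rp to-r
      in ≤-trans bound (+-monoʳ-≤ _ (≤-trans (n≤1+n (2 + M)) (charge-bound M<K)))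
    ... | no rp≱1 =
      let (M , M<K , _ , bound) = charge rest PPp≢Pp (≤-trans (s≤s z≤n) (rank-parent p Pp≢p)) (to-r ∘ there)
      in ≤-trans (add-charge {d = 1} {e = 2 + M} zero-potential bound) (+-monoʳ-≤ _ (charge-bound M<K))
      where
      zero-potential : suc (φ₁ p) ≤ φ₀ p + 1
      zero-potential = ≤-trans (s≤s (≤-trans (φ≤ P′ S p) (≤-reflexive K*rp≡0))) (m≤n+m 1 (φ₀ p))
        where
        K*rp≡0 : K * rank (S p) ≡ 0
        K*rp≡0 = trans (cong (K *_) (n<1⇒n≡0 (≰⇒> rp≱1))) (*-zeroʳ K)

  find-potential : ∀ {n} {s : State n} {u p ps r} → Balanced s u → (∀ x → rank (size s x) < Ack K 1) →
                   Path (parent s) p ps r → Φ (st (compress (parent s) ps r) (size s)) + length ps ≤ Φ s + (K + 3)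
  find-potential {s = s} {ps = ps} {r} bal rank<Ack path = +-cancelʳ-≤ (∑ φ₀ ps) _ _ (begin
    sum φ₁ + length ps + ∑ φ₀ ps      ≡⟨ swap (sum φ₁) (length ps) (∑ φ₀ ps) ⟩
    sum φ₁ + ∑ φ₀ ps + length ps      ≡⟨ cong (_+ length ps) exchange ⟩
    sum φ₀ + ∑ φ₁ ps + length ps      ≡⟨ +-assoc (sum φ₀) (∑ φ₁ ps) (length ps) ⟩
    sum φ₀ + (∑ φ₁ ps + length ps)    ≤⟨ +-monoʳ-≤ (sum φ₀) (find-charge path (compress-on-path (parent s) ps r)) ⟩
    sum φ₀ + (∑ φ₀ ps + (K + 3))      ≡⟨ swap′ (sum φ₀) (∑ φ₀ ps) (K + 3) ⟩
    sum φ₀ + (K + 3) + ∑ φ₀ ps        ∎)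
    where
    open Balanced bal
    open Compression (parent s) (size s) doubling size-pos rank<Ack (compress (parent s) ps r)
    open PathProperties (parent s) (size s) doubling size-pos
    open ≤-Reasoning
    exchange : sum φ₁ + ∑ φ₀ ps ≡ sum φ₀ + ∑ φ₁ ps
    exchange = sum-exchange-list φ₁ φ₀ (path-unique path) λ x x∉ps →
      φ-parent-cong (parent s) (compress (parent s) ps r) (size s) (compress-off-path (parent s) ps r x∉ps)
    swap : ∀ a b c → a + b + c ≡ a + c + b
    swap = solve-∀
    swap′ : ∀ a b c → a + (b + c) ≡ a + c + b
    swap′ = solve-∀

  union-potential : ∀ {n} {s : State n} {u} → Balanced s u → ∀ w l → parent s w ≡ w → parent s l ≡ l →
                    w ≢ l → size s l ≤ size s w →
                    Φ (st (upd (parent s) l w) (upd (size s) w (size s w + size s l))) ≤ Φ s + K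
  union-potential bal w l w-root l-root w≢l l≤w = sum-mono-except w K (λ x x≢w → others x x≢w (x ≟ l)) at-w
    where
    open Union bal w l w-root l-root w≢l l≤w
    open Balanced bal
    others : ∀ x → x ≢ w → Dec (x ≡ l) → φ P′ S′ x ≤ φ P S x
    others x x≢w (yes refl) = begin
      φ P′ S′ x        ≤⟨ φ≤ P′ S′ x ⟩
      K * rank (S′ x)  ≡⟨ cong (λ a → K * rank a) (upd-other S w _ x≢w) ⟩
      K * rank (S x)   ≡⟨ φ-root P S l-root ⟨
      φ P S x          ∎
      where open ≤-Reasoning
    others x x≢w (no x≢l) = begin
      φ P′ S′ x        ≡⟨ φ-parent-cong P P′ S′ (upd-other P l w x≢l) ⟩
      φ P S′ x         ≤⟨ φ-anti P x (upd-other S w _ x≢w) (rank-mono (size-grows (P x))) ⟩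
      φ P S x          ∎
      where open ≤-Reasoning
    at-w : φ P′ S′ w ≤ φ P S w + K
    at-w = begin
      φ P′ S′ w               ≡⟨ φ-root P′ S′ (trans (upd-other P l w w≢l) w-root) ⟩
      K * rank (S′ w)         ≡⟨ cong (λ a → K * rank a) (upd-same S w _) ⟩
      K * rank (S w + S l)    ≤⟨ *-monoʳ-≤ K (rank-union (size-pos w) l≤w) ⟩
      K * suc (rank (S w))    ≡⟨ *-suc K (rank (S w)) ⟩
      K + K * rank (S w)      ≡⟨ +-comm K _ ⟩
      K * rank (S w) + K      ≡⟨ cong (_+ K) (φ-root P S w-root) ⟨
      φ P S w + K             ∎
      where open ≤-Reasoning


  module Amortised {N} (N<Ack : N < Ack K 1) where

    union-step : ∀ {n} {s : State n} {ops s₂ cs} u → Balanced s u →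
                 u + suc (numUnions ops) ≤ N →
                 ∀ w l → parent s w ≡ w → parent s l ≡ l → w ≢ l → size s l ≤ size s w →
                 Run (st (upd (parent s) l w) (upd (size s) w (size s w + size s l))) ops s₂ cs →
                 suc cs + Φ s₂ ≤ Φ s + (K + 3) * (numFinds ops + suc (numUnions ops))

    run-potential : ∀ {n} {s : State n} {ops s′ c} u → Balanced s u →
                    u + numUnions ops ≤ N → Run s ops s′ c →
                    c + Φ s′ ≤ Φ s + (K + 3) * (numFinds ops + numUnions ops)
    run-potential u bal u+U≤N nil = m≤m+n _ _
    run-potential {s = s} u bal u+U≤N (cons {ops = ops} {s₂ = s₂} {cs = cs} (findStep {ps = ps} path) run) = begin
      length ps + cs + Φ s₂         ≡⟨ +-assoc (length ps) cs (Φ s₂) ⟩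
      length ps + (cs + Φ s₂)       ≤⟨ +-monoʳ-≤ (length ps) (run-potential u (balanced-compress bal path) u+U≤N run) ⟩
      length ps + (Φ s₁ + rest)     ≡⟨ regroup (length ps) (Φ s₁) rest ⟩
      Φ s₁ + length ps + rest       ≤⟨ +-monoˡ-≤ rest (find-potential bal rank<Ack path) ⟩
      Φ s + (K + 3) + rest          ≡⟨ +-assoc (Φ s) (K + 3) rest ⟩
      Φ s + ((K + 3) + rest)        ≡⟨ cong (Φ s +_) (*-suc (K + 3) _) ⟨
      Φ s + (K + 3) * suc (numFinds ops + numUnions ops) ∎
      where
      open ≤-Reasoning
      open Balanced bal
      s₁ = st (compress (parent s) ps _) (size s)
      rest = (K + 3) * (numFinds ops + numUnions ops)
      rank<Ack : ∀ x → rank (size s x) < Ack K 1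
      rank<Ack x = ≤-<-trans (≤-trans (rank≤ u (size≤2ᵘ x)) (≤-trans (m≤m+n u _) u+U≤N)) N<Ack
      regroup : ∀ a b c → a + (b + c) ≡ b + a + c
      regroup = solve-∀
    run-potential u bal u+U≤N (cons (unionKeep {a = a} {b = b} a-root b-root a≢b a≮b) run) =
      union-step u bal u+U≤N a b a-root b-root a≢b (≮⇒≥ a≮b) run
    run-potential u bal u+U≤N (cons (unionSwap {a = a} {b = b} a-root b-root a≢b a<b) run) =
      union-step u bal u+U≤N b a b-root a-root (a≢b ∘ sym) (<⇒≤ a<b) run

    union-step {s = s} {ops} {s₂} {cs} u bal u+U≤N w l w-root l-root w≢l l≤w run = begin
      suc (cs + Φ s₂)               ≤⟨ s≤s (run-potential (suc u) balanced-union (subst (_≤ N) (+-suc u _) u+U≤N) run) ⟩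
      suc (Φ s₁ + rest)             ≤⟨ s≤s (+-monoˡ-≤ rest (union-potential bal w l w-root l-root w≢l l≤w)) ⟩
      suc (Φ s + K + rest)          ≡⟨ regroup (Φ s) K rest ⟩
      Φ s + (suc K + rest)          ≤⟨ +-monoʳ-≤ (Φ s) (+-monoˡ-≤ rest 1+K≤K+3) ⟩
      Φ s + ((K + 3) + rest)        ≡⟨ cong (Φ s +_) (*-suc (K + 3) _) ⟨
      Φ s + (K + 3) * suc (numFinds ops + numUnions ops)
                                    ≡⟨ cong (λ t → Φ s + (K + 3) * t) (+-suc (numFinds ops) _) ⟨
      Φ s + (K + 3) * (numFinds ops + suc (numUnions ops)) ∎
      where
      open ≤-Reasoning
      open Union bal w l w-root l-root w≢l l≤w
      s₁ = st P′ S′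
      rest = (K + 3) * (numFinds ops + numUnions ops)
      regroup : ∀ a k x → suc (a + k + x) ≡ a + (suc k + x)
      regroup = solve-∀
      1+K≤K+3 : suc K ≤ K + 3
      1+K≤K+3 = ≤-trans (≤-reflexive (+-comm 1 K)) (+-monoʳ-≤ K (s≤s z≤n))

balanced-init : ∀ n → Balanced (initState n) 0
balanced-init n = record
  { doubling = λ x moved → contradiction refl moved ; size-pos = λ _ → ≤-refl ; size≤2ᵘ = λ _ → ≤-refl }

run-cost≤ : ∀ K {n} → 0 < K → n < Ack K 1 → ∀ {ops s′ cost} → Run (initState n) ops s′ cost → numUnions ops ≤ n →
        cost ≤ (K + 3) * (numFinds ops + numUnions ops)
run-cost≤ K {n} 0<K n<Ack {ops} {s′} {cost} run unions≤n = begin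
  cost                        ≤⟨ m≤m+n cost (Φ s′) ⟩
  cost + Φ s′                 ≤⟨ run-potential 0 (balanced-init n) unions≤n run ⟩
  Φ (initState n) + amortised ≡⟨ cong (_+ amortised) initial-potential ⟩
  amortised                   ∎
  where
  open ≤-Reasoning
  open Potential K 0<K
  open Amortised n<Ack
  amortised = (K + 3) * (numFinds ops + numUnions ops)
  initial-potential : Φ (initState n) ≡ 0
  initial-potential = n≤0⇒n≡0 (≤-trans (sum-bound {n} 0 rank-0) (≤-reflexive (*-zeroʳ n)))
    where
    rank-0 : ∀ x → φ (λ y → y) (λ _ → 1) x ≤ 0
    rank-0 x = ≤-trans (φ≤ (λ y → y) (λ _ → 1) x) (≤-reflexive (trans (cong (K *_) rank-1) (*-zeroʳ K)))

8+L≤9L : ∀ {L} → 1 ≤ L → 5 + L + 3 ≤ 9 * L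
8+L≤9L {suc L} _ = ≤-trans (m≤m+n (5 + suc L + 3) (8 * L)) (≤-reflexive (regroup L))
  where
  regroup : ∀ L → 5 + suc L + 3 + 8 * L ≡ 9 * suc L
  regroup = solve-∀

mainTheorem3 : Σ ℕ λ C → ∀ (n : ℕ) → 2 ≤ n → ∀ (m : ℕ) (ops : List (Op n))
    (s' : State n) (cost : ℕ) → Run (initState n) ops s' cost →
    numUnions ops ≤ n → numFinds ops ≡ m →
    ∀ (L : ℕ) → IsLogStarStar (ℕ→ℚ n) L →
    cost ≤ C * (m + n) * L
mainTheorem3 = 9 , λ n 2≤n m ops s′ cost run unions≤n finds≡m L logStar² →
  let (1≤L , n<Ack) = IsLogStarStar⇒<Ack 2≤n logStar² in begin
    cost                                          ≤⟨ run-cost≤ (5 + L) (s≤s z≤n) n<Ack run unions≤n ⟩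
    (5 + L + 3) * (numFinds ops + numUnions ops)  ≤⟨ *-mono-≤ (8+L≤9L 1≤L) (+-mono-≤ (≤-reflexive finds≡m) unions≤n) ⟩
    9 * L * (m + n)                               ≡⟨ regroup L m n ⟩
    9 * (m + n) * L                               ∎
  where
  open ≤-Reasoning
  regroup : ∀ L m n → 9 * L * (m + n) ≡ 9 * (m + n) * L
  regroup = solve-∀
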